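{- Let $G$ be a strongly connected signed digraph on $[n]$ without positive cycles which is not a cycle. If $\tau(G)\leq 1$, then there is a word $w$ of length $3n-1$ which synchronizes every and-or-net on $G$.
   Context: A signed digraph $G$ on a finite vertex set $V$ is a pair $(V,E)$ with $E\subseteq V\times V\times\{ -1,1\}$; $(j,i,s)\in E$ is an arc from $j$ to $i$ of sign $s$ (loops allowed). Cycles are subgraphs without repeated vertices; the sign of a cycle is the product of its arc signs. Unsigned notions refer to the underlying digraph. $\tau(G)$ is the minimum size of a feedback vertex set of $G$, i.e. of a set of vertices meeting every cycle. A Boolean network (BN) with component set $V$ is a map $f:\{0,1\}^V\to\{0,1\}^V$; its signed interaction digraph has a positive (resp. negative) arc from $j$ to $i$ iff some $x$ with $x_j=0$ has $f_i(x+e_j)-f_i(x)>0$ (resp. $<0$), $x+e_j$ being $x$ with component $j$ flipped; a BN on $G$ has signed interaction digraph $G$. $f^i(x)$ equals $x$ except its $i$-th component is $f_i(x)$; $f^w=f^{i_\ell}\circ\cdots\circ f^{i_1}$ for $w=i_1\dots i_\ell$; $w$ synchronizes $f$ if $f^w$ is constant. $f_i$ is a conjunction if $f_i(x)=1$ iff $x_j=1$ for every positive in-neighbor $j$ of $i$ and $x_j=0$ for every negative in-neighbor; a disjunction if $f_i(x)=0$ iff $x_j=0$ for every positive in-neighbor and $x_j=1$ for every negative in-neighbor. An and-or-net on $G$ is a BN on $G$ all of whose components are conjunctions or disjunctions. -}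

module Defs where

open import Data.Nat using (ℕ; zero; suc; _≤_)
open import Data.Nat.DivMod using (_mod_)
open import Data.Fin using (Fin; toℕ)
open import Data.Fin.Subset using (Subset; _∈_; ∣_∣)
open import Data.Bool using (Bool; true; false; not; if_then_else_)
open import Data.List using (List; []; _∷_)
open import Data.Product using (Σ; ∃; _×_; _,_)
open import Data.Sum using (_⊎_)
open import Function.Definitions using (Injective)
open import Relation.Binary.PropositionalEquality using (_≡_)
open import Relation.Nullary using (¬_)
open import Data.Fin using (_≟_)

data Sign : Set where
  pos neg : Sign

_·_ : Sign → Sign → Sign
pos · s = s
neg · pos = neg
neg · neg = pos

prodSign : ∀ k → (Fin k → Sign) → Sign
prodSign zero    s = pos
prodSign (suc k) s = s Fin.zero · prodSign k (λ t → s (Fin.suc t))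

-- A signed digraph on [n]: E j i s = true iff (j,i,s) is an arc from j to i of sign s
SignedDigraph : ℕ → Set
SignedDigraph n = Fin n → Fin n → Sign → Bool

next : ∀ {m} → Fin (suc m) → Fin (suc m)
next {m} t = suc (toℕ t) mod suc m

-- A cycle of G: distinct vertices v_0 .. v_len (len+1 ≥ 1 of them), with an arc
-- of sign sgn t from v_t to v_{t+1 mod (len+1)} for every t.
record Cycle {n : ℕ} (G : SignedDigraph n) : Set where
  field
    len  : ℕ
    vtx  : Fin (suc len) → Fin n
    inj  : Injective _≡_ _≡_ vtx
    sgn  : Fin (suc len) → Sign
    arcs : ∀ t → G (vtx t) (vtx (next t)) (sgn t) ≡ true

cycleSign : ∀ {n} {G : SignedDigraph n} → Cycle G → Sign
cycleSign C = prodSign (suc (Cycle.len C)) (Cycle.sgn C)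

NoPositiveCycle : ∀ {n} → SignedDigraph n → Set
NoPositiveCycle G = (C : Cycle G) → ¬ (cycleSign C ≡ pos)

IsCycle : ∀ {n} → SignedDigraph n → Set
IsCycle {n} G = Σ (Cycle G) λ C →
  ((v : Fin n) → ∃ λ t → Cycle.vtx C t ≡ v) ×
  ((j i : Fin n) (s : Sign) → G j i s ≡ true →
     ∃ λ t → Cycle.vtx C t ≡ j × Cycle.vtx C (next t) ≡ i × Cycle.sgn C t ≡ s)

data Reach {n : ℕ} (G : SignedDigraph n) (i : Fin n) : Fin n → Set where
  here : Reach G i i
  step : ∀ {j k} (s : Sign) → Reach G i j → G j k s ≡ true → Reach G i k

StronglyConnected : ∀ {n} → SignedDigraph n → Set
StronglyConnected {n} G = (i j : Fin n) → Reach G i j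

FeedbackVertexSet : ∀ {n} → SignedDigraph n → Subset n → Set
FeedbackVertexSet G S = (C : Cycle G) → ∃ λ t → Cycle.vtx C t ∈ S

-- τ(G) ≤ k  (τ = minimum size of a feedback vertex set)
τ≤ : ∀ {n} → SignedDigraph n → ℕ → Set
τ≤ {n} G k = Σ (Subset n) λ S → FeedbackVertexSet G S × ∣ S ∣ ≤ k

Config : ℕ → Set
Config n = Fin n → Bool

BN : ℕ → Set
BN n = Config n → Config n

flip : ∀ {n} → Config n → Fin n → Config n
flip x j k with j ≟ k
... | Relation.Nullary.yes _ = not (x k)
... | Relation.Nullary.no  _ = x k

PosInfluence : ∀ {n} → BN n → Fin n → Fin n → Set
PosInfluence f j i = ∃ λ x → x j ≡ false × f x i ≡ false × f (flip x j) i ≡ true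

NegInfluence : ∀ {n} → BN n → Fin n → Fin n → Set
NegInfluence f j i = ∃ λ x → x j ≡ false × f x i ≡ true × f (flip x j) i ≡ false

-- f is a BN on G: its signed interaction digraph is G
BNOn : ∀ {n} → SignedDigraph n → BN n → Set
BNOn G f = ∀ j i →
  ((G j i pos ≡ true → PosInfluence f j i) × (PosInfluence f j i → G j i pos ≡ true)) ×
  ((G j i neg ≡ true → NegInfluence f j i) × (NegInfluence f j i → G j i neg ≡ true))

IsConjunction : ∀ {n} → SignedDigraph n → BN n → Fin n → Set
IsConjunction {n} G f i = ∀ x →
  let P = ((j : Fin n) → G j i pos ≡ true → x j ≡ true) ×
          ((j : Fin n) → G j i neg ≡ true → x j ≡ false)
  in (f x i ≡ true → P) × (P → f x i ≡ true)

IsDisjunction : ∀ {n} → SignedDigraph n → BN n → Fin n → Set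
IsDisjunction {n} G f i = ∀ x →
  let P = ((j : Fin n) → G j i pos ≡ true → x j ≡ false) ×
          ((j : Fin n) → G j i neg ≡ true → x j ≡ true)
  in (f x i ≡ false → P) × (P → f x i ≡ false)

AndOrNet : ∀ {n} → SignedDigraph n → BN n → Set
AndOrNet {n} G f = BNOn G f × ((i : Fin n) → IsConjunction G f i ⊎ IsDisjunction G f i)

update : ∀ {n} → BN n → Fin n → Config n → Config n
update f i x k with i ≟ k
... | Relation.Nullary.yes _ = f x k
... | Relation.Nullary.no  _ = x k

-- f^w = f^{i_ℓ} ∘ ... ∘ f^{i_1} for w = i_1 ... i_ℓ
applyWord : ∀ {n} → BN n → List (Fin n) → Config n → Config n
applyWord f []      x = x
applyWord f (i ∷ w) x = applyWord f w (update f i x)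

Synchronizes : ∀ {n} → BN n → List (Fin n) → Set
Synchronizes {n} f w = (x y : Config n) (k : Fin n) → applyWord f w x k ≡ applyWord f w y k

-- Fix a vertex v meeting every cycle. Then G − v is acyclic, so the other vertices can be
-- listed in topological order T, and since every cycle is negative there is a switching σ
-- after which all arcs are positive except those entering v, which are negative. Hence updating
-- v and then T brings any configuration x "in phase" c = f(x)_v, meaning x_u = σ_u ⊙ c for all u,
-- and updating v once more flips v alone. Going backwards from v along vertices with a single
-- in-neighbour must reach a vertex z with two in-neighbours p, q, for otherwise G is a cycle (or
-- has a vertex without in-arcs, hence a single vertex). Now update, in topological order, p and
-- the vertices of G − v ranked below q, which follow v's flip, and the path A from z to v: z sees
-- a flipped and an unflipped input, so it takes its absorbing value whatever x was, A carries this
-- to v, and a final pass through T propagates the agreement at v everywhere. With L the vertices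
-- updated in the middle, the word v T v L v T has at most 3n − 1 letters because L misses q.

module Submission where

open import Defs
open import Data.Bool using (Bool; true; false; not)
open import Data.Bool.Properties using (¬-not; not-¬; not-involutive)
open import Data.Empty using (⊥-elim)
open import Data.List using (List; []; _∷_; _++_; map; allFin; length; filter; replicate)
open import Data.List.Membership.Propositional.Properties using (∈-map⁺; ∈-allFin; ∈-filter⁺)
open import Data.List.Properties using (length-map; length-tabulate; filter-notAll; length-++; length-replicate)
open import Data.List.Relation.Binary.Permutation.Propositional using (↭-sym)
open import Data.List.Relation.Binary.Permutation.Propositional.Properties using (↭-length; ∈-resp-↭; All-resp-↭)
open import Data.List.Membership.Propositional using (_∈_; _∉_)
open import Data.List.Relation.Unary.All using (All; []; _∷_)
import Data.List.Relation.Unary.All as All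
import Data.List.Relation.Unary.All.Properties as Allₚ
import Data.List.Relation.Unary.AllPairs.Properties as AllPairsₚ
open import Data.List.Relation.Unary.AllPairs using (AllPairs; []; _∷_)
open import Data.List.Relation.Unary.Linked.Properties using (Linked⇒AllPairs)
open import Data.List.Relation.Unary.Any using (here; there)
import Data.List.Relation.Unary.Any as Any
open import Data.Fin using (Fin; zero; suc; toℕ; inject₁; fromℕ; punchIn; punchOut; _≟_)
open import Data.Fin.Relation.Unary.Top using (view; ‵fromℕ; ‵inject₁)
open import Data.Fin.Subset using (Subset; ∣_∣; ⁅_⁆; _⊆_; _⊂_) renaming (_∈_ to _∈ₛ_)
open import Data.Fin.Subset.Properties using (nonempty?; p⊂q⇒∣p∣<∣q∣; ∣⁅x⁆∣≡1; x∈⁅y⁆⇒x≡y; x≢y⇒x∉⁅y⁆)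
open import Data.Fin.Properties
  using (toℕ<n; toℕ-injective; toℕ-inject₁; inject₁ℕ<; toℕ-fromℕ; toℕ-fromℕ<; any?; all?; ¬∀⟶∃¬;
         pigeonhole; punchOut-injective; punchIn-punchOut; punchInᵢ≢i)
open import Data.Nat using (ℕ; zero; suc; _+_; _*_; _∸_; _≤_; _<_; z≤n; s≤s; s≤s⁻¹; s<s⁻¹; _%_)
open import Data.Nat.DivMod using (m<n⇒m%n≡m; n%n≡0)
open import Data.Nat.Induction using (<-rec)
open import Data.Nat.Properties
  using (≤-refl; ≤-trans; <-irrefl; <-≤-trans; <⇒≤; m≤n⇒m≤1+n; m≤n⇒m<n∨m≡n; ≮⇒≥; _<?_; _≤?_; ≰⇒>;
         ≤-decTotalOrder; ≤-reflexive; +-identityʳ; +-suc; <⇒≱; +-monoˡ-≤; m≤n+m; m∸n+n≡m; ≤⇒≯;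
         module ≤-Reasoning)
open import Data.Nat.Tactic.RingSolver using (solve-∀)
open import Data.Product using (Σ; ∃; ∃₂; _×_; _,_; proj₁; proj₂)
open import Data.Sum using (_⊎_; inj₁; inj₂; reduce; [_,_])
open import Data.Unit using (⊤; tt)
open import Function.Definitions using (Injective)
open import Relation.Binary.PropositionalEquality using (_≡_; _≢_; refl; sym; trans; cong; subst; module ≡-Reasoning)
import Relation.Binary.Construct.On as On
open import Relation.Nullary using (¬_; Dec; yes; no; contradiction)
open import Relation.Nullary.Decidable using (_×-dec_; _⊎-dec_; ¬?)
open import Relation.Unary using (Decidable)

·-assoc : ∀ a b c → (a · b) · c ≡ a · (b · c)
·-assoc pos b   c   = refl
·-assoc neg pos c   = refl
·-assoc neg neg pos = refl
·-assoc neg neg neg = refl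

·-identityʳ : ∀ a → a · pos ≡ a
·-identityʳ pos = refl
·-identityʳ neg = refl

·-cancelʳ : ∀ a b c → a · c ≡ b · c → a ≡ b
·-cancelʳ pos pos _   _  = refl
·-cancelʳ neg neg _   _  = refl
·-cancelʳ pos neg pos ()
·-cancelʳ pos neg neg ()
·-cancelʳ neg pos pos ()
·-cancelʳ neg pos neg ()

·-cancelˡ : ∀ c a b → c · a ≡ c · b → a ≡ b
·-cancelˡ pos a   b   eq = eq
·-cancelˡ neg pos pos _  = refl
·-cancelˡ neg neg neg _  = refl
·-cancelˡ neg pos neg ()
·-cancelˡ neg neg pos ()

≢pos⇒neg : ∀ {s} → s ≢ pos → s ≡ neg
≢pos⇒neg {pos} s≢pos = ⊥-elim (s≢pos refl)
≢pos⇒neg {neg} _     = refl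

-- A sign acts on a Boolean by negating it or not; [s ⊙ x j] is the literal of j in an arc of sign s.
_⊙_ : Sign → Bool → Bool
pos ⊙ b = b
neg ⊙ b = not b

⊙-· : ∀ s t b → s ⊙ (t ⊙ b) ≡ (t · s) ⊙ b
⊙-· pos pos b     = refl
⊙-· pos neg b     = refl
⊙-· neg pos b     = refl
⊙-· neg neg false = refl
⊙-· neg neg true  = refl

⊙-not : ∀ s b → s ⊙ not b ≡ not (s ⊙ b)
⊙-not pos b = refl
⊙-not neg b = refl

⊙-transpose : ∀ s {b c} → s ⊙ b ≡ c → b ≡ s ⊙ c
⊙-transpose pos refl = refl
⊙-transpose neg refl = sym (not-involutive _)

≢not⇒≡ : ∀ {a b} → a ≢ not b → a ≡ b
≢not⇒≡ {a} {b} a≢¬b = trans (¬-not a≢¬b) (not-involutive b)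

bool-≡ : ∀ {a b : Bool} c → (a ≡ c → b ≡ c) → (b ≡ c → a ≡ c) → a ≡ b
bool-≡ {false} {false} _     _ _ = refl
bool-≡ {true}  {true}  _     _ _ = refl
bool-≡ {false} {true}  false f _ = contradiction (f refl) λ ()
bool-≡ {false} {true}  true  _ g = contradiction (g refl) λ ()
bool-≡ {true}  {false} false _ g = contradiction (g refl) λ ()
bool-≡ {true}  {false} true  f _ = contradiction (f refl) λ ()

toℕ-next : ∀ {m} (t : Fin (suc m)) → toℕ (next t) ≡ suc (toℕ t) % suc m
toℕ-next t = toℕ-fromℕ< _

next-fromℕ : ∀ m → next (fromℕ m) ≡ zero
next-fromℕ m = toℕ-injective (begin
  toℕ (next (fromℕ m))         ≡⟨ toℕ-next (fromℕ m) ⟩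
  suc (toℕ (fromℕ m)) % suc m  ≡⟨ cong (λ k → suc k % suc m) (toℕ-fromℕ m) ⟩
  suc m % suc m                ≡⟨ n%n≡0 (suc m) ⟩
  0                            ∎)
  where open ≡-Reasoning

next-inject₁ : ∀ {m} (t : Fin m) → next (inject₁ t) ≡ suc t
next-inject₁ {m} t = toℕ-injective (begin
  toℕ (next (inject₁ t))           ≡⟨ toℕ-next (inject₁ t) ⟩
  suc (toℕ (inject₁ t)) % suc m    ≡⟨ cong (λ k → suc k % suc m) (toℕ-inject₁ t) ⟩
  suc (toℕ t) % suc m              ≡⟨ m<n⇒m%n≡m (s≤s (toℕ<n t)) ⟩
  suc (toℕ t)                      ∎)
  where open ≡-Reasoning

next-surjective : ∀ {m} (t′ : Fin (suc m)) → ∃ λ t → next t ≡ t′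
next-surjective {m}     zero    = fromℕ m , next-fromℕ m
next-surjective {suc m} (suc t) = inject₁ t , next-inject₁ t

MeetsEveryCycle : ∀ {n} → SignedDigraph n → Fin n → Set
MeetsEveryCycle G v = (C : Cycle G) → ∃ λ t → Cycle.vtx C t ≡ v

HasInput : ∀ {n} → SignedDigraph n → Fin n → Set
HasInput G u = ∃₂ λ j s → G j u s ≡ true

module Walks {n : ℕ} (G : SignedDigraph n) where

  data Walk : Fin n → Fin n → ℕ → Set where
    nil  : ∀ {u} → Walk u u 0
    cons : ∀ {u w x k} (s : Sign) → G u w s ≡ true → Walk w x k → Walk u x (suc k)

  vertex : ∀ {u x k} → Walk u x k → Fin (suc k) → Fin n
  vertex {u} _            zero    = u
  vertex     (cons _ _ W) (suc t) = vertex W t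

  signAt : ∀ {u x k} → Walk u x k → Fin k → Sign
  signAt (cons s _ _) zero    = s
  signAt (cons _ _ W) (suc t) = signAt W t

  arcAt : ∀ {u x k} (W : Walk u x k) (t : Fin k) →
          G (vertex W (inject₁ t)) (vertex W (suc t)) (signAt W t) ≡ true
  arcAt (cons _ a _) zero    = a
  arcAt (cons _ _ W) (suc t) = arcAt W t

  vertex-last : ∀ {u x k} (W : Walk u x k) → vertex W (fromℕ k) ≡ x
  vertex-last nil          = refl
  vertex-last (cons _ _ W) = vertex-last W

  walkSign : ∀ {u x k} → Walk u x k → Sign
  walkSign nil          = pos
  walkSign (cons s _ W) = s · walkSign W

  prodSign-signAt : ∀ {u x k} (W : Walk u x k) → prodSign k (signAt W) ≡ walkSign W
  prodSign-signAt nil          = refl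
  prodSign-signAt (cons s _ W) = cong (s ·_) (prodSign-signAt W)

  snoc : ∀ {u x y k} → Walk u x k → (s : Sign) → G x y s ≡ true → Walk u y (suc k)
  snoc nil            s a = cons s a nil
  snoc (cons s′ a′ W) s a = cons s′ a′ (snoc W s a)

  walkSign-snoc : ∀ {u x y k} (W : Walk u x k) s (a : G x y s ≡ true) →
                  walkSign (snoc W s a) ≡ walkSign W · s
  walkSign-snoc nil           s a = ·-identityʳ s
  walkSign-snoc (cons s′ _ W) s a =
    trans (cong (s′ ·_) (walkSign-snoc W s a)) (sym (·-assoc s′ (walkSign W) s))

  _++ʷ_ : ∀ {u x y k l} → Walk u x k → Walk x y l → Walk u y (k + l)
  nil        ++ʷ P = P
  cons s a W ++ʷ P = cons s a (W ++ʷ P)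

  walkSign-++ : ∀ {u x y k l} (W : Walk u x k) (P : Walk x y l) →
                walkSign (W ++ʷ P) ≡ walkSign W · walkSign P
  walkSign-++ nil          P = refl
  walkSign-++ (cons s _ W) P =
    trans (cong (s ·_) (walkSign-++ W P)) (sym (·-assoc s (walkSign W) (walkSign P)))

  take : ∀ {u x k} (W : Walk u x k) (t : Fin (suc k)) → Walk u (vertex W t) (toℕ t)
  take _            zero    = nil
  take (cons s a W) (suc t) = cons s a (take W t)

  -- Every vertex of W except its last one differs from v.
  Avoids : ∀ {u x k} → Fin n → Walk u x k → Set
  Avoids v nil              = ⊤
  Avoids v (cons {u} _ _ W) = u ≢ v × Avoids v W

  avoids-vertex : ∀ {v u x k} (W : Walk u x k) → Avoids v W → ∀ t → vertex W (inject₁ t) ≢ v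
  avoids-vertex (cons _ _ _) (u≢v , _) zero    = u≢v
  avoids-vertex (cons _ _ W) (_ , avW) (suc t) = avoids-vertex W avW t

  avoids-snoc : ∀ {v u x y k} (W : Walk u x k) s (a : G x y s ≡ true) →
                Avoids v W → x ≢ v → Avoids v (snoc W s a)
  avoids-snoc nil          s a _           x≢v = x≢v , tt
  avoids-snoc (cons _ _ W) s a (u≢v , avW) x≢v = u≢v , avoids-snoc W s a avW x≢v

  avoids-++ : ∀ {v u x y k l} (W : Walk u x k) (P : Walk x y l) →
              Avoids v W → Avoids v P → Avoids v (W ++ʷ P)
  avoids-++ nil          P _           avP = avP
  avoids-++ (cons _ _ W) P (u≢v , avW) avP = u≢v , avoids-++ W P avW avP

  avoids-take : ∀ {v u x k} (W : Walk u x k) t → Avoids v W → Avoids v (take W t)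
  avoids-take _            zero    _           = tt
  avoids-take (cons _ _ W) (suc t) (u≢v , avW) = u≢v , avoids-take W t avW

  -- The vertices of W other than its last one are pairwise distinct.
  Distinct : ∀ {u x k} → Walk u x k → Set
  Distinct nil              = ⊤
  Distinct (cons {u} _ _ W) = (∀ t → vertex W (inject₁ t) ≢ u) × Distinct W

  distinct-injective : ∀ {u x k} (W : Walk u x k) → Distinct W →
                       Injective _≡_ _≡_ (λ t → vertex W (inject₁ t))
  distinct-injective (cons _ _ W) _         {zero}  {zero}  _ = refl
  distinct-injective (cons _ _ W) (new , _) {zero}  {suc j} e = ⊥-elim (new j (sym e))
  distinct-injective (cons _ _ W) (new , _) {suc i} {zero}  e = ⊥-elim (new i e)
  distinct-injective (cons _ _ W) (_ , d)   {suc i} {suc j} e = cong suc (distinct-injective W d e)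

  record ClosedSubwalk {u x k} (W : Walk u x k) : Set where
    field
      {base}  : Fin n
      len     : ℕ
      walk    : Walk base base (suc len)
      shorter : suc len < k
      avoids  : ∀ {v} → Avoids v W → Avoids v walk

  split : ∀ {u x k} (W : Walk u x k) → Distinct W ⊎ ClosedSubwalk W
  split nil = inj₁ tt
  split (cons {u} s a W) with split W
  ... | inj₂ sub = inj₂ record
    { walk = walk ; shorter = m≤n⇒m≤1+n shorter ; avoids = λ av → avoids (proj₂ av) }
    where open ClosedSubwalk sub
  ... | inj₁ d with any? (λ t → vertex W (inject₁ t) ≟ u)
  ...   | no u-fresh = inj₁ ((λ t e → u-fresh (t , e)) , d)
  ...   | yes (t , e) = inj₂ record
    { walk    = close (cons s a (take W (inject₁ t))) e
    ; shorter = s≤s (inject₁ℕ< t)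
    ; avoids  = λ { (u≢v , avW) → avoids-close _ e (u≢v , avoids-take W (inject₁ t) avW) }
    }
    where
    close : ∀ {y l} → Walk u y l → y ≡ u → Walk u u l
    close B refl = B
    avoids-close : ∀ {v y l} (B : Walk u y l) (e : y ≡ u) → Avoids v B → Avoids v (close B e)
    avoids-close B refl avB = avB

  vertex-next : ∀ {y k} (B : Walk y y (suc k)) (t : Fin (suc k)) →
                vertex B (suc t) ≡ vertex B (inject₁ (next t))
  vertex-next {k = k} B t with view t
  ... | ‵fromℕ     = trans (vertex-last B) (cong (λ i → vertex B (inject₁ i)) (sym (next-fromℕ k)))
  ... | ‵inject₁ j = cong (λ i → vertex B (inject₁ i)) (sym (next-inject₁ j))

  toCycle : ∀ {y k} (B : Walk y y (suc k)) → Distinct B → Cycle G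
  toCycle {k = k} B d = record
    { len  = k
    ; vtx  = λ t → vertex B (inject₁ t)
    ; inj  = distinct-injective B d
    ; sgn  = signAt B
    ; arcs = λ t → subst (λ w → G (vertex B (inject₁ t)) w (signAt B t) ≡ true) (vertex-next B t) (arcAt B t)
    }

  cycleSign-toCycle : ∀ {y k} (B : Walk y y (suc k)) (d : Distinct B) → cycleSign (toCycle B d) ≡ walkSign B
  cycleSign-toCycle B _ = prodSign-signAt B

update-self : ∀ {n} (f : BN n) i x → update f i x i ≡ f x i
update-self f i x with i ≟ i
... | yes _   = refl
... | no i≢i = contradiction refl i≢i

update-other : ∀ {n} (f : BN n) {i k} x → i ≢ k → update f i x k ≡ x k
update-other f {i} {k} x i≢k with i ≟ k
... | yes i≡k = contradiction i≡k i≢k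
... | no _    = refl

applyWord-++ : ∀ {n} (f : BN n) w₁ w₂ x → applyWord f (w₁ ++ w₂) x ≡ applyWord f w₂ (applyWord f w₁ x)
applyWord-++ f []       w₂ x = refl
applyWord-++ f (i ∷ w₁) w₂ x = applyWord-++ f w₁ w₂ (update f i x)

synchronizes-++ˡ : ∀ {n} (f : BN n) r {w} → Synchronizes f w → Synchronizes f (r ++ w)
synchronizes-++ˡ f r {w} sync x y k = begin
  applyWord f (r ++ w) x k           ≡⟨ cong (λ z → z k) (applyWord-++ f r w x) ⟩
  applyWord f w (applyWord f r x) k  ≡⟨ sync _ _ k ⟩
  applyWord f w (applyWord f r y) k  ≡⟨ cong (λ z → z k) (applyWord-++ f r w y) ⟨
  applyWord f (r ++ w) y k           ∎
  where open ≡-Reasoning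

TopologicallySorted : ∀ {n} → SignedDigraph n → List (Fin n) → Set
TopologicallySorted G []      = ⊤
TopologicallySorted G (u ∷ L) = (∀ {j s} → G j u s ≡ true → j ∉ u ∷ L) × TopologicallySorted G L

SynchronizingWord : ∀ {n} → SignedDigraph n → List (Fin n) → Set
SynchronizingWord G w = (f : BN _) → AndOrNet G f → Synchronizes f w

propagate : ∀ {n} {G : SignedDigraph n} (f : BN n) (R : Fin n → Bool → Bool → Set) (Q : Fin n → Set) →
  (∀ {u} x y → Q u → (∀ {j s} → G j u s ≡ true → R j (x j) (y j)) → R u (f x u) (f y u)) →
  ∀ L → TopologicallySorted G L → All Q L → ∀ x y → (∀ {w} → w ∉ L → R w (x w) (y w)) →
  ∀ w → R w (applyWord f L x w) (applyWord f L y w)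
propagate f R Q establish []      _                   _          x y R-out w = R-out λ ()
propagate f R Q establish (u ∷ L) (sorted , L-sorted) (Qu ∷ QL) x y R-out =
  propagate f R Q establish L L-sorted QL (update f u x) (update f u y) R-out′
  where
  R-out′ : ∀ {w} → w ∉ L → R w (update f u x w) (update f u y w)
  R-out′ {w} w∉L with u ≟ w
  ... | yes refl = establish x y Qu (λ a → R-out (sorted a))
  ... | no  u≢w  = R-out λ { (here w≡u) → u≢w (sym w≡u) ; (there w∈L) → w∉L w∈L }

propagate₁ : ∀ {n} {G : SignedDigraph n} (f : BN n) (P : Fin n → Bool → Set) (Q : Fin n → Set) →
  (∀ {u} x → Q u → (∀ {j s} → G j u s ≡ true → P j (x j)) → P u (f x u)) →
  ∀ L → TopologicallySorted G L → All Q L → ∀ x → (∀ {w} → w ∉ L → P w (x w)) →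
  ∀ w → P w (applyWord f L x w)
propagate₁ f P Q establish L sorted QL x P-out =
  propagate f (λ w b _ → P w b) Q (λ x _ Qu h → establish x Qu h) L sorted QL x x P-out

module AndOr {n} (G : SignedDigraph n) {f : BN n}
             (andOr : (i : Fin n) → IsConjunction G f i ⊎ IsDisjunction G f i) where

  Inputs : Config n → Fin n → Bool → Set
  Inputs x i b = ∀ {j s} → G j i s ≡ true → s ⊙ x j ≡ b

  private
    inputs⇒condition : ∀ {x i} b → Inputs x i b →
      ((j : Fin n) → G j i pos ≡ true → x j ≡ b) × ((j : Fin n) → G j i neg ≡ true → x j ≡ not b)
    inputs⇒condition b h = (λ j a → h a) , (λ j a → ⊙-transpose neg (h a))

    condition⇒inputs : ∀ {x i} b →
      ((j : Fin n) → G j i pos ≡ true → x j ≡ b) × ((j : Fin n) → G j i neg ≡ true → x j ≡ not b) →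
      Inputs x i b
    condition⇒inputs b (h₊ , h₋) {j} {pos} a = h₊ j a
    condition⇒inputs b (h₊ , h₋) {j} {neg} a = trans (cong not (h₋ j a)) (not-involutive b)

  -- A conjunction (absorbing value false) or disjunction (absorbing value true) outputs the
  -- non-absorbing value exactly when all its input literals have that value.
  gate : ∀ i → Σ Bool λ d → ∀ x → (f x i ≡ not d → Inputs x i (not d)) × (Inputs x i (not d) → f x i ≡ not d)
  gate i with andOr i
  ... | inj₁ conj = false , λ x → (λ e → condition⇒inputs true (proj₁ (conj x) e))
                                 , (λ h → proj₂ (conj x) (inputs⇒condition true h))
  ... | inj₂ disj = true  , λ x → (λ e → condition⇒inputs false (proj₁ (disj x) e))
                                 , (λ h → proj₂ (disj x) (inputs⇒condition false h))

  absorbing : Fin n → Bool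
  absorbing i = proj₁ (gate i)

  unanimous : ∀ {x i b j s} → G j i s ≡ true → Inputs x i b → f x i ≡ b
  unanimous {x} {i} {b} a h with gate i
  ... | d , spec = bool-≡ (not d) (λ e → trans (sym (h a)) (proj₁ (spec x) e a))
                                   (λ e → proj₂ (spec x) (λ a′ → trans (h a′) e))

  mixed : ∀ {x i b j s j′ s′} → G j i s ≡ true → G j′ i s′ ≡ true →
          s ⊙ x j ≡ b → s′ ⊙ x j′ ≡ not b → f x i ≡ absorbing i
  mixed {x} {i} {b} a a′ l l′ with gate i
  ... | d , spec = ≢not⇒≡ λ e →
    let all¬d = proj₁ (spec x) e
    in  contradiction (trans (trans (sym l) (all¬d a)) (sym (trans (sym l′) (all¬d a′)))) (not-¬ refl)

  local : ∀ {x y i} → (∀ {j s} → G j i s ≡ true → x j ≡ y j) → f x i ≡ f y i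
  local {x} {y} {i} agree with gate i
  ... | d , spec = bool-≡ (not d) (λ e → proj₂ (spec y) (transport (proj₁ (spec x) e)))
                                   (λ e → proj₂ (spec x) (transport′ (proj₁ (spec y) e)))
    where
    transport : Inputs x i (not d) → Inputs y i (not d)
    transport h {s = s} a = trans (cong (s ⊙_) (sym (agree a))) (h a)
    transport′ : Inputs y i (not d) → Inputs x i (not d)
    transport′ h {s = s} a = trans (cong (s ⊙_) (agree a)) (h a)

arc? : ∀ {n} (G : SignedDigraph n) p u → Dec (∃ λ s → G p u s ≡ true)
arc? G p u with G p u pos in e₊ | G p u neg in e₋
... | true  | _     = yes (pos , e₊)
... | false | true  = yes (neg , e₋)
... | false | false = no λ { (pos , a) → contradiction (trans (sym a) e₊) λ ()
                           ; (neg , a) → contradiction (trans (sym a) e₋) λ () }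

-- The largest k < N satisfying P, or 0 if there is none.
greatest : ∀ {P : ℕ → Set} → Decidable P → ℕ → ℕ
greatest P? zero    = 0
greatest P? (suc N) with P? N
... | yes _ = N
... | no  _ = greatest P? N

≤-greatest : ∀ {P : ℕ → Set} (P? : Decidable P) {k} N → P k → k < N → k ≤ greatest P? N
≤-greatest P? (suc N) Pk k<1+N with P? N | m≤n⇒m<n∨m≡n (s≤s⁻¹ k<1+N)
... | yes _  | inj₁ k<N  = <⇒≤ k<N
... | yes _  | inj₂ refl = ≤-refl
... | no _   | inj₁ k<N  = ≤-greatest P? N Pk k<N
... | no ¬PN | inj₂ refl = contradiction Pk ¬PN

greatest-satisfies : ∀ {P : ℕ → Set} (P? : Decidable P) N → P 0 → P (greatest P? N)
greatest-satisfies P? zero    P0 = P0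
greatest-satisfies P? (suc N) P0 with P? N
... | yes PN = PN
... | no  _  = greatest-satisfies P? N P0

module FeedbackVertex {m} (G : SignedDigraph (suc m)) (v : Fin (suc m)) (fvs : MeetsEveryCycle G v) where

  open Walks G

  ¬closed-avoids : ∀ {y k} (B : Walk y y (suc k)) → ¬ Avoids v B
  ¬closed-avoids {k = k} = <-rec P go k
    where
    P : ℕ → Set
    P k = ∀ {y} (B : Walk y y (suc k)) → ¬ Avoids v B
    go : ∀ k → (∀ {l} → l < k → P l) → P k
    go k shorter-ok B avB with split B
    ... | inj₁ d   = let (t , e) = fvs (toCycle B d) in avoids-vertex B avB t e
    ... | inj₂ sub = shorter-ok (s<s⁻¹ shorter) walk (avoids avB)
      where open ClosedSubwalk sub

  record Excursion (u : Fin (suc m)) : Set where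
    constructor excursion
    field
      {second} : Fin (suc m)
      sign₁    : Sign
      first    : G v second sign₁ ≡ true
      {len}    : ℕ
      rest     : Walk second u len
      avoids   : Avoids v rest

    toWalk : Walk v u (suc len)
    toWalk = cons sign₁ first rest

  open Excursion public using (toWalk)

  excursionSign : ∀ {u} → Excursion u → Sign
  excursionSign E = walkSign (toWalk E)

  extendExcursion : ∀ {j u s} → Excursion j → G j u s ≡ true → j ≢ v → Excursion u
  extendExcursion (excursion s₁ a₁ W avW) a j≢v = excursion s₁ a₁ (snoc W _ a) (avoids-snoc W _ a avW j≢v)

  excursionSign-extend : ∀ {j u s} (E : Excursion j) (a : G j u s ≡ true) (j≢v : j ≢ v) →
                         excursionSign (extendExcursion E a j≢v) ≡ excursionSign E · s
  excursionSign-extend {s = s} E a _ = walkSign-snoc (toWalk E) s a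

  excursion-distinct : (E : Excursion v) → Distinct (toWalk E)
  excursion-distinct (excursion _ _ W avW) with split W
  ... | inj₁ d   = avoids-vertex W avW , d
  ... | inj₂ sub = ⊥-elim (¬closed-avoids walk (avoids avW))
    where open ClosedSubwalk sub

  private
    v≢vertex : ∀ {u x k} (W : Walk u x k) → Avoids v W → ∀ t → v ≢ vertex W (inject₁ t)
    v≢vertex W avW t e = avoids-vertex W avW t (sym e)

  avoiding-length< : ∀ {u x k} (W : Walk u x k) → Avoids v W → k < suc m
  avoiding-length< {k = k} W avW with split W
  ... | inj₂ sub = ⊥-elim (¬closed-avoids walk (avoids avW))
    where open ClosedSubwalk sub
  ... | inj₁ d with k <? suc m
  ...   | yes k<n = k<n
  ...   | no  k≮n with pigeonhole (≮⇒≥ k≮n) (λ t → punchOut (v≢vertex W avW t))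
  ...     | i , j , i<j , e = contradiction i<j (<-irrefl (cong toℕ (distinct-injective W d
                                (punchOut-injective (v≢vertex W avW i) (v≢vertex W avW j) e))))

  data EndsWalk : ℕ → Fin (suc m) → Set where
    start  : ∀ {u} → u ≢ v → EndsWalk 0 u
    extend : ∀ {k p u s} → G p u s ≡ true → u ≢ v → EndsWalk k p → EndsWalk (suc k) u

  endsWalk? : ∀ k u → Dec (EndsWalk k u)
  endsWalk? zero u with u ≟ v
  ... | yes u≡v = no λ { (start u≢v) → u≢v u≡v }
  ... | no  u≢v = yes (start u≢v)
  endsWalk? (suc k) u with u ≟ v | any? (λ p → arc? G p u ×-dec endsWalk? k p)
  ... | yes u≡v | _                      = no λ { (extend _ u≢v _) → u≢v u≡v }
  ... | no  u≢v | yes (_ , (_ , a) , e) = yes (extend a u≢v e)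
  ... | no  _   | no  none               = no λ { (extend a _ e) → none (_ , (_ , a) , e) }

  endsWalk-≢ : ∀ {k u} → EndsWalk k u → u ≢ v
  endsWalk-≢ (start u≢v)      = u≢v
  endsWalk-≢ (extend _ u≢v _) = u≢v

  endsWalk-length< : ∀ {k u} → EndsWalk k u → k < suc m
  endsWalk-length< e = let (_ , W , avW) = walk e in avoiding-length< W avW
    where
    walk : ∀ {k u} → EndsWalk k u → ∃₂ λ x (W : Walk x u k) → Avoids v W
    walk (start _) = _ , nil , tt
    walk (extend {s = s} a _ e) =
      let (x , W , avW) = walk e in x , snoc W s a , avoids-snoc W s a avW (endsWalk-≢ e)

  rank : Fin (suc m) → ℕ
  rank u = greatest (λ k → endsWalk? k u) (suc m)

  rank-arc : ∀ {p u s} → G p u s ≡ true → p ≢ v → u ≢ v → rank p < rank u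
  rank-arc {p} {u} a p≢v u≢v = ≤-greatest (λ k → endsWalk? k u) (suc m) e (endsWalk-length< e)
    where
    e = extend a u≢v (greatest-satisfies (λ k → endsWalk? k p) (suc m) (start p≢v))

  rank-walk : ∀ {x y k} (W : Walk x y k) → Avoids v W → y ≢ v → rank x ≤ rank y
  rank-walk nil          _           _   = ≤-refl
  rank-walk (cons s a W) (x≢v , avW) y≢v =
    <⇒≤ (<-≤-trans (rank-arc a x≢v (start≢v W avW)) (rank-walk W avW y≢v))
    where
    start≢v : ∀ {w k} (W : Walk w _ k) → Avoids v W → w ≢ v
    start≢v nil          _         = y≢v
    start≢v (cons _ _ _) (w≢v , _) = w≢v

  topologicallySorted : ∀ {L} → AllPairs (λ u w → rank u ≤ rank w) L → All (_≢ v) L → TopologicallySorted G L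
  topologicallySorted []                  []            = tt
  topologicallySorted (u≤L ∷ L-sorted) (u≢v ∷ L≢v) = earlier , topologicallySorted L-sorted L≢v
    where
    earlier : ∀ {j s} → G j _ s ≡ true → j ∉ _
    earlier a (here refl)  = <-irrefl refl (rank-arc a u≢v u≢v)
    earlier a (there j∈L) = <-irrefl refl (<-≤-trans (rank-arc a (All.lookup L≢v j∈L) u≢v) (All.lookup u≤L j∈L))

  rank-along : ∀ {c x k} (W : Walk c x k) → Avoids v W → ∀ t → rank c ≤ rank (vertex W (inject₁ t))
  rank-along W avW t = rank-walk (take W (inject₁ t)) (avoids-take W (inject₁ t) avW) (avoids-vertex W avW t)

  input∉avoiding : ∀ {c x k q s} (W : Walk c x k) → Avoids v W → G q c s ≡ true → q ≢ v →
                   ∀ t → vertex W (inject₁ t) ≢ q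
  input∉avoiding (cons _ _ _) avW@(c≢v , _) a q≢v t refl =
    <-irrefl refl (<-≤-trans (rank-arc a q≢v c≢v) (rank-along _ avW t))

  open import Data.List.Sort (On.decTotalOrder ≤-decTotalOrder rank) using (sort; sort-↭; sort-↗)

  others : List (Fin (suc m))
  others = sort (map (punchIn v) (allFin m))

  others-sorted : AllPairs (λ u w → rank u ≤ rank w) others
  others-sorted = Linked⇒AllPairs ≤-trans (sort-↗ _)

  others-≢ : All (_≢ v) others
  others-≢ = All-resp-↭ (↭-sym (sort-↭ _)) (Allₚ.map⁺ (Allₚ.tabulate⁺ (punchInᵢ≢i v)))

  others-complete : ∀ {u} → u ≢ v → u ∈ others
  others-complete u≢v = ∈-resp-↭ (↭-sym (sort-↭ _))
    (subst (_∈ _) (punchIn-punchOut v≢u) (∈-map⁺ (punchIn v) (∈-allFin (punchOut v≢u))))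
    where v≢u = λ e → u≢v (sym e)

  length-others : length others ≡ m
  length-others = trans (↭-length (sort-↭ _)) (trans (length-map (punchIn v) (allFin m)) (length-tabulate _))

module Signature {m} (G : SignedDigraph (suc m)) (v : Fin (suc m)) (no+ : NoPositiveCycle G)
                 (fvs : MeetsEveryCycle G v) (sc : StronglyConnected G) where

  open Walks G
  open FeedbackVertex G v fvs

  excursion-negative : (E : Excursion v) → excursionSign E ≡ neg
  excursion-negative E = ≢pos⇒neg λ e → no+ (toCycle (toWalk E) d) (trans (cycleSign-toCycle (toWalk E) d) e)
    where d = excursion-distinct E

  -- Cut a walk from u at its first visit to v.
  returnWalk : ∀ u → ∃₂ λ k (W : Walk u v k) → Avoids v W
  returnWalk u = reduce (toV (sc u v))
    where
    toV : ∀ {y} → Reach G u y →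
          (∃₂ λ k (W : Walk u y k) → Avoids v W) ⊎ (∃₂ λ k (W : Walk u v k) → Avoids v W)
    toV here = inj₁ (0 , nil , tt)
    toV (step {j} s r a) with toV r
    ... | inj₂ P = inj₂ P
    ... | inj₁ (k , W , avW) with j ≟ v
    ...   | yes refl = inj₂ (k , W , avW)
    ...   | no j≢v   = inj₁ (suc k , snoc W s a , avoids-snoc W s a avW j≢v)

  excursionSign-unique : ∀ {u} (E E′ : Excursion u) → excursionSign E ≡ excursionSign E′
  excursionSign-unique {u} E E′ with returnWalk u
  ... | _ , P , avP = ·-cancelʳ _ _ (walkSign P) (trans (closing E) (sym (closing E′)))
    where
    closing : (E : Excursion u) → excursionSign E · walkSign P ≡ neg
    closing E@(excursion s a W avW) =
      trans (sym (walkSign-++ (toWalk E) P)) (excursion-negative (excursion s a (W ++ʷ P) (avoids-++ W P avW avP)))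

  -- Cut a walk from v at its last visit to v.
  excursionTo : ∀ {u} → u ≢ v → Excursion u
  excursionTo {u} u≢v with fromV (sc v u)
    where
    fromV : ∀ {y} → Reach G v y → y ≡ v ⊎ Excursion y
    fromV here = inj₁ refl
    fromV (step {j} s r a) with j ≟ v | fromV r
    ... | yes refl | _         = inj₂ (excursion s a nil tt)
    ... | no  j≢v  | inj₁ j≡v = contradiction j≡v j≢v
    ... | no  j≢v  | inj₂ E   = inj₂ (extendExcursion E a j≢v)
  ... | inj₁ u≡v = contradiction u≡v u≢v
  ... | inj₂ E   = E

  private
    switchSign : ∀ {u} → Dec (u ≡ v) → Sign → Sign
    switchSign (yes _)   s = s
    switchSign (no u≢v) _ = excursionSign (excursionTo u≢v)

  -- σ is the switching of G that makes all arcs not entering v positive; [arrival u] is the sign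
  -- with which walks from v arrive at u, which for u = v is the sign of every cycle through v.
  σ arrival : Fin (suc m) → Sign
  σ       u = switchSign (u ≟ v) pos
  arrival u = switchSign (u ≟ v) neg

  σ-v : σ v ≡ pos
  σ-v with v ≟ v
  ... | yes _   = refl
  ... | no  v≢v = contradiction refl v≢v

  arrival-v : arrival v ≡ neg
  arrival-v with v ≟ v
  ... | yes _   = refl
  ... | no  v≢v = contradiction refl v≢v

  σ≡arrival : ∀ {u} → u ≢ v → σ u ≡ arrival u
  σ≡arrival {u} u≢v with u ≟ v
  ... | yes u≡v = contradiction u≡v u≢v
  ... | no  _   = refl

  excursionSign≡arrival : ∀ {u} (E : Excursion u) → excursionSign E ≡ arrival u
  excursionSign≡arrival {u} E with u ≟ v
  ... | yes refl = excursion-negative E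
  ... | no  u≢v  = excursionSign-unique E (excursionTo u≢v)

  σ-arc : ∀ {j u s} → G j u s ≡ true → σ j · s ≡ arrival u
  σ-arc {j} {u} {s} a with j ≟ v
  ... | yes refl = trans (sym (·-identityʳ s)) (excursionSign≡arrival (excursion s a nil tt))
  ... | no  j≢v  = begin
    excursionSign E · s                      ≡⟨ excursionSign-extend E a j≢v ⟨
    excursionSign (extendExcursion E a j≢v)  ≡⟨ excursionSign≡arrival (extendExcursion E a j≢v) ⟩
    arrival u                                ∎
    where
    open ≡-Reasoning
    E = excursionTo j≢v

  parallel-arcs : ∀ {j u s s′} → G j u s ≡ true → G j u s′ ≡ true → s ≡ s′
  parallel-arcs {j} a a′ = ·-cancelˡ (σ j) _ _ (trans (σ-arc a) (sym (σ-arc a′)))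

-- The data for the middle round of the synchronizing word: z has an input p that has been
-- flipped together with v and an input q that has not, so z takes its absorbing value in every run.
record Mixer {m} (G : SignedDigraph (suc m)) (v : Fin (suc m)) : Set₁ where
  field
    z p q    : Fin (suc m)
    {sp sq}  : Sign
    p→z      : G p z sp ≡ true
    q→z      : G q z sq ≡ true
    InA InS  : Fin (suc m) → Set
    A?       : Decidable InA
    S?       : Decidable InS
    v∉A      : ¬ InA v
    A-closed : ∀ {u j s} → InA u → u ≢ z → G j u s ≡ true → InA j
    v-inputs : z ≢ v → ∀ {j s} → G j v s ≡ true → InA j
    S-closed : ∀ {u j s} → InS u → G j u s ≡ true → j ≢ v → InS j
    p-flips  : p ≡ v ⊎ InS p
    q≢v      : q ≢ v
    q∉A      : ¬ InA q
    q∉S      : ¬ InS q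

module Synchronization {m} (G : SignedDigraph (suc m)) (v : Fin (suc m)) (no+ : NoPositiveCycle G)
                       (fvs : MeetsEveryCycle G v) (sc : StronglyConnected G)
                       (has-input : ∀ u → HasInput G u) (M : Mixer G v) where

  open FeedbackVertex G v fvs
  open Signature G v no+ fvs sc
  open Mixer M

  Changing : Fin (suc m) → Set
  Changing u = InA u ⊎ InS u

  changing? : Decidable Changing
  changing? u = A? u ⊎-dec S? u

  middle : List (Fin (suc m))
  middle = filter changing? others

  middle-sorted : TopologicallySorted G middle
  middle-sorted = topologicallySorted (AllPairsₚ.filter⁺ changing? others-sorted) (Allₚ.filter⁺ changing? others-≢)

  word : List (Fin (suc m))
  word = v ∷ others ++ v ∷ middle ++ v ∷ others

  length-middle< : length middle < m
  length-middle< = subst (length middle <_) length-others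
    (filter-notAll changing? others (Any.map (λ { refl → [ q∉A , q∉S ] }) (others-complete q≢v)))

  length-word : length word ≤ 3 * suc m ∸ 1
  length-word = begin
    length word                                          ≡⟨ length-unfold ⟩
    suc (length others + suc (l + suc (length others)))  ≡⟨ cong (λ t → suc (t + suc (l + suc t))) length-others ⟩
    suc (m + suc (l + suc m))                            ≡⟨ regroup m l ⟩
    suc l + (m + suc (suc m))                            ≤⟨ +-monoˡ-≤ (m + suc (suc m)) length-middle< ⟩
    m + (m + suc (suc m))                                ≡⟨ three-times m ⟩
    3 * suc m ∸ 1                                        ∎
    where
    open ≤-Reasoning
    l = length middle
    length-unfold : length word ≡ suc (length others + suc (l + suc (length others)))
    length-unfold = cong suc (trans (length-++ others) (cong (λ k → length others + suc k) (length-++ middle)))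
    regroup : ∀ m l → suc (m + suc (l + suc m)) ≡ suc l + (m + suc (suc m))
    regroup = solve-∀
    three-times : ∀ m → m + (m + suc (suc m)) ≡ m + (suc m + (suc m + 0))
    three-times = solve-∀

  module Dynamics {f : BN (suc m)} (andOr : (i : Fin (suc m)) → IsConjunction G f i ⊎ IsDisjunction G f i) where

    open AndOr G andOr

    InPhase : Bool → Fin (suc m) → Bool → Set
    InPhase c u b = b ≡ σ u ⊙ c

    literal-in-phase : ∀ {c} {x : Config (suc m)} {j u s} → InPhase c j (x j) → G j u s ≡ true →
                       s ⊙ x j ≡ arrival u ⊙ c
    literal-in-phase {c} {x} {j} {u} {s} h a = begin
      s ⊙ x j        ≡⟨ cong (s ⊙_) h ⟩
      s ⊙ (σ j ⊙ c)  ≡⟨ ⊙-· s (σ j) c ⟩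
      (σ j · s) ⊙ c  ≡⟨ cong (_⊙ c) (σ-arc a) ⟩
      arrival u ⊙ c  ∎
      where open ≡-Reasoning

    update-in-phase : ∀ {c} {x : Config (suc m)} {u} → (∀ {j s} → G j u s ≡ true → InPhase c j (x j)) →
                      f x u ≡ arrival u ⊙ c
    update-in-phase {x = x} {u} h =
      let (_ , _ , a) = has-input u in unanimous a (λ a′ → literal-in-phase {x = x} (h a′) a′)

    phase-step : ∀ {c} {x : Config (suc m)} {u} → u ≢ v → (∀ {j s} → G j u s ≡ true → InPhase c j (x j)) →
                 InPhase c u (f x u)
    phase-step {c} u≢v h = trans (update-in-phase h) (cong (_⊙ c) (sym (σ≡arrival u≢v)))

    v-flips : ∀ {c} {x : Config (suc m)} → (∀ w → InPhase c w (x w)) → InPhase (not c) v (f x v)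
    v-flips {c} {x} h = begin
      f x v          ≡⟨ update-in-phase (λ _ → h _) ⟩
      arrival v ⊙ c  ≡⟨ cong (_⊙ c) arrival-v ⟩
      not c          ≡⟨ cong (_⊙ not c) σ-v ⟨
      σ v ⊙ not c    ∎
      where open ≡-Reasoning

    mixing : ∀ {c} {x : Config (suc m)} {u j₁ j₂ s₁ s₂} → G j₁ u s₁ ≡ true → G j₂ u s₂ ≡ true →
             InPhase c j₁ (x j₁) → InPhase (not c) j₂ (x j₂) → f x u ≡ absorbing u
    mixing {c} {x} {u} a₁ a₂ h₁ h₂ =
      mixed a₁ a₂ (literal-in-phase {x = x} h₁ a₁) (trans (literal-in-phase {x = x} h₂ a₂) (⊙-not (arrival u) c))

    others-in-phase : ∀ {c} x → x v ≡ c → ∀ w → InPhase c w (applyWord f others x w)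
    others-in-phase {c} x xv≡c =
      propagate₁ f (InPhase c) (_≢ v) (λ _ u≢v h → phase-step u≢v h)
                 others (topologicallySorted others-sorted others-≢) others-≢ x initial
      where
      initial : ∀ {w} → w ∉ others → InPhase c w (x w)
      initial {w} w∉ with w ≟ v
      ... | yes refl = xv≡c
      ... | no  w≢v  = contradiction (others-complete w≢v) w∉

    Flipped Untouched : Fin (suc m) → Set
    Flipped u   = u ≡ v ⊎ InS u
    Untouched u = u ≢ v × ¬ InA u × ¬ InS u

    record Settled (c₁ c₂ : Bool) (u : Fin (suc m)) (b₁ b₂ : Bool) : Set where
      field
        agree     : InA u → b₁ ≡ b₂
        flipped   : Flipped u → InPhase (not c₁) u b₁ × InPhase (not c₂) u b₂
        untouched : Untouched u → InPhase c₁ u b₁ × InPhase c₂ u b₂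
    open Settled

    inputs-flip : ∀ {u j s} → InS u → G j u s ≡ true → Flipped j
    inputs-flip {j = j} uS a with j ≟ v
    ... | yes j≡v = inj₁ j≡v
    ... | no  j≢v = inj₂ (S-closed uS a j≢v)

    agreement : ∀ {c₁ c₂} x y {u} → (u ≢ z → ∀ {j s} → G j u s ≡ true → InA j) →
                (∀ {j s} → G j u s ≡ true → Settled c₁ c₂ j (x j) (y j)) → f x u ≡ f y u
    agreement x y {u} closed settled with u ≟ z
    ... | yes refl = trans (mixing q→z p→z (proj₁ q-untouched) (proj₁ p-flipped))
                           (sym (mixing q→z p→z (proj₂ q-untouched) (proj₂ p-flipped)))
      where
      q-untouched = untouched (settled q→z) (q≢v , q∉A , q∉S)
      p-flipped   = flipped (settled p→z) p-flips
    ... | no  u≢z  = local λ a → agree (settled a) (closed u≢z a)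

    middle-step : ∀ {c₁ c₂ u} x y → u ≢ v × Changing u →
                  (∀ {j s} → G j u s ≡ true → Settled c₁ c₂ j (x j) (y j)) → Settled c₁ c₂ u (f x u) (f y u)
    middle-step x y (u≢v , A⊎S) settled = record
      { agree     = λ uA → agreement x y (λ u≢z → A-closed uA u≢z) settled
      ; flipped   = λ { (inj₁ u≡v) → contradiction u≡v u≢v
                      ; (inj₂ uS) → phase-step u≢v (λ a → proj₁ (flipped (settled a) (inputs-flip uS a)))
                                  , phase-step u≢v (λ a → proj₂ (flipped (settled a) (inputs-flip uS a))) }
      ; untouched = λ (_ , ¬A , ¬S) → contradiction A⊎S [ ¬A , ¬S ]
      }

    first-round : Config (suc m) → Config (suc m)
    first-round x = update f v (applyWord f others (update f v x))

    first-round-v : ∀ x → InPhase (not (f x v)) v (first-round x v)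
    first-round-v x = trans (update-self f v _) (v-flips (others-in-phase (update f v x) (update-self f v x)))

    first-round-≢v : ∀ x {w} → w ≢ v → InPhase (f x v) w (first-round x w)
    first-round-≢v x w≢v =
      trans (update-other f _ (λ e → w≢v (sym e))) (others-in-phase (update f v x) (update-self f v x) _)

    first-round-settled : ∀ x y {w} → w ∉ middle → Settled (f x v) (f y v) w (first-round x w) (first-round y w)
    first-round-settled x y {w} w∉ with w ≟ v
    ... | yes refl = record
      { agree     = λ vA → contradiction vA v∉A
      ; flipped   = λ _ → first-round-v x , first-round-v y
      ; untouched = λ (v≢v , _) → contradiction refl v≢v
      }
    ... | no  w≢v  = record
      { agree     = λ wA → contradiction (∈-filter⁺ changing? (others-complete w≢v) (inj₁ wA)) w∉
      ; flipped   = λ { (inj₁ w≡v) → contradiction w≡v w≢v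
                      ; (inj₂ wS)  → contradiction (∈-filter⁺ changing? (others-complete w≢v) (inj₂ wS)) w∉ }
      ; untouched = λ _ → first-round-≢v x w≢v , first-round-≢v y w≢v
      }

    second-round : Config (suc m) → Config (suc m)
    second-round x = applyWord f middle (first-round x)

    second-round-settled : ∀ x y w → Settled (f x v) (f y v) w (second-round x w) (second-round y w)
    second-round-settled x y =
      propagate f (Settled (f x v) (f y v)) (λ u → u ≢ v × Changing u) middle-step middle middle-sorted
        (All.zip (Allₚ.filter⁺ changing? others-≢ , Allₚ.all-filter changing? others))
        (first-round x) (first-round y) (first-round-settled x y)

    third-round-agrees : ∀ x y w → applyWord f others (update f v (second-round x)) w
                                 ≡ applyWord f others (update f v (second-round y)) w
    third-round-agrees x y =
      propagate f (λ _ b₁ b₂ → b₁ ≡ b₂) (_≢ v) (λ x y _ agree → local agree)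
        others (topologicallySorted others-sorted others-≢) others-≢ _ _ initial
      where
      initial : ∀ {w} → w ∉ others → update f v (second-round x) w ≡ update f v (second-round y) w
      initial {w} w∉ with w ≟ v
      ... | no  w≢v  = contradiction (others-complete w≢v) w∉
      ... | yes refl = begin
        update f v (second-round x) v  ≡⟨ update-self f v _ ⟩
        f (second-round x) v           ≡⟨ agreement _ _ (λ v≢z → v-inputs (λ e → v≢z (sym e)))
                                                        (λ _ → second-round-settled x y _) ⟩
        f (second-round y) v           ≡⟨ update-self f v _ ⟨
        update f v (second-round y) v  ∎
        where open ≡-Reasoning

    applyWord-word : ∀ x → applyWord f word x ≡ applyWord f others (update f v (second-round x))
    applyWord-word x = trans (applyWord-++ f others (v ∷ middle ++ v ∷ others) (update f v x))
                             (applyWord-++ f middle (v ∷ others) (first-round x))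

    word-synchronizes : Synchronizes f word
    word-synchronizes x y k = begin
      applyWord f word x k                                 ≡⟨ cong (λ c → c k) (applyWord-word x) ⟩
      applyWord f others (update f v (second-round x)) k  ≡⟨ third-round-agrees x y k ⟩
      applyWord f others (update f v (second-round y)) k  ≡⟨ cong (λ c → c k) (applyWord-word y) ⟨
      applyWord f word y k                                 ∎
      where open ≡-Reasoning

  synchronizing : SynchronizingWord G word
  synchronizing f (_ , andOr) = Dynamics.word-synchronizes andOr

module Chain {m} (G : SignedDigraph (suc m)) (v : Fin (suc m)) (no+ : NoPositiveCycle G)
             (fvs : MeetsEveryCycle G v) (sc : StronglyConnected G)
             (has-input : ∀ u → HasInput G u) where

  open Walks G
  open FeedbackVertex G v fvs
  open Signature G v no+ fvs sc

  Forced : ∀ {u x k} → Walk u x k → Set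
  Forced {k = k} W =
    ∀ (t : Fin k) {j s} → G j (vertex W (suc t)) s ≡ true → j ≡ vertex W (inject₁ t) × s ≡ signAt W t

  forced-cons : ∀ {c j x k s} (a : G j c s ≡ true) (W : Walk c x k) → Forced W →
                (∀ {j′ s′} → G j′ c s′ ≡ true → j′ ≡ j × s′ ≡ s) → Forced (cons s a W)
  forced-cons a W _      only zero    a′ = only a′
  forced-cons a W forced _    (suc t) a′ = forced t a′

  forced-isCycle : (E : Excursion v) → Forced (toWalk E) → IsCycle G
  forced-isCycle E forced = C , on-C , arc-of-C
    where
    B = toWalk E
    C = toCycle B (excursion-distinct E)
    open Cycle C using (vtx; sgn)

    into-C : ∀ t′ {j s′} → G j (vtx t′) s′ ≡ true → ∃ λ t → vtx t ≡ j × vtx (next t) ≡ vtx t′ × sgn t ≡ s′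
    into-C t′ a′ with next-surjective t′
    ... | t , refl with forced t (subst (λ y → G _ y _ ≡ true) (sym (vertex-next B t)) a′)
    ...   | refl , refl = t , refl , refl , refl

    backward : ∀ {u y} → Reach G u y → (∃ λ t → vtx t ≡ y) → ∃ λ t → vtx t ≡ u
    backward here             on-y      = on-y
    backward (step _ r a′) (t′ , refl) = let (t , e , _) = into-C t′ a′ in backward r (t , e)

    on-C : ∀ u → ∃ λ t → vtx t ≡ u
    on-C u = backward (sc u (vtx zero)) (zero , refl)

    arc-of-C : ∀ j i s′ → G j i s′ ≡ true → ∃ λ t → vtx t ≡ j × vtx (next t) ≡ i × sgn t ≡ s′
    arc-of-C j i s′ a′ with on-C i
    ... | t′ , refl = into-C t′ a′

  record TwoInputs (u : Fin (suc m)) : Set where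
    field
      {j₁ j₂ s₁ s₂} : _
      arc₁     : G j₁ u s₁ ≡ true
      arc₂     : G j₂ u s₂ ≡ true
      distinct : j₁ ≢ j₂

  record SingleInput (u : Fin (suc m)) : Set where
    constructor singleInput
    field
      j    : Fin (suc m)
      s    : Sign
      arc  : G j u s ≡ true
      only : ∀ {j′ s′} → G j′ u s′ ≡ true → j′ ≡ j × s′ ≡ s

  classify : ∀ u → TwoInputs u ⊎ SingleInput u
  classify u with has-input u
  ... | j , s , a with any? (λ j′ → ¬? (j′ ≟ j) ×-dec arc? G j′ u)
  ...   | yes (_ , j′≢j , _ , a′) = inj₁ record { arc₁ = a ; arc₂ = a′ ; distinct = λ e → j′≢j (sym e) }
  ...   | no  none                 = inj₂ (singleInput j s a only)
    where
    only : ∀ {j′ s′} → G j′ u s′ ≡ true → j′ ≡ j × s′ ≡ s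
    only {j′} a′ with j′ ≟ j
    ... | yes refl = refl , parallel-arcs a′ a
    ... | no  j′≢j = contradiction (j′ , j′≢j , _ , a′) none

  record MixSite : Set where
    field
      {z}    : Fin (suc m)
      {k}    : ℕ
      path   : Walk z v k
      avoids : Avoids v path
      forced : Forced path
      inputs : TwoInputs z

  -- Follow single in-arcs backwards from v: this stays in G − v, where it cannot go on for m steps,
  -- and returning to v would make G a cycle.
  mixSite : ¬ IsCycle G → MixSite
  mixSite ¬cycle = go (suc m) nil tt (λ ()) ≤-refl
    where
    go : ∀ F {c k} (W : Walk c v k) → Avoids v W → Forced W → suc m ≤ k + F → MixSite
    go zero    W avW _  n≤k+0 = contradiction (≤-trans n≤k+0 (≤-reflexive (+-identityʳ _))) (<⇒≱ (avoiding-length< W avW))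
    go (suc F) {c} W avW fW n≤k+F with classify c
    ... | inj₁ two = record { path = W ; avoids = avW ; forced = fW ; inputs = two }
    ... | inj₂ (singleInput j s a only) with j ≟ v
    ...   | yes refl = contradiction (forced-isCycle (excursion s a W avW) (forced-cons a W fW only)) ¬cycle
    ...   | no  j≢v  = go F (cons s a W) (j≢v , avW) (forced-cons a W fW only) (subst (suc m ≤_) (+-suc _ F) n≤k+F)

  last-input : ∀ {c k} (W : Walk c v k) → Forced W → c ≢ v → ∀ {j s} → G j v s ≡ true →
               ∃ λ t → vertex W (inject₁ t) ≡ j
  last-input nil _ c≢v _ = contradiction refl c≢v
  last-input W@(cons {k = k} _ _ _) forced _ a =
    fromℕ k , sym (proj₁ (forced (fromℕ k) (subst (λ y → G _ y _ ≡ true) (sym (vertex-last W)) a)))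

  record OrderedInputs (z : Fin (suc m)) : Set where
    field
      p q     : Fin (suc m)
      {sp sq} : Sign
      p→z     : G p z sp ≡ true
      q→z     : G q z sq ≡ true
      p≢q     : p ≢ q
      q≢v     : q ≢ v
      p≤q     : p ≢ v → rank p ≤ rank q

  order : ∀ {z} → TwoInputs z → OrderedInputs z
  order {z} two = by-cases (j₁ ≟ v) (j₂ ≟ v)
    where
    open TwoInputs two
    by-cases : Dec (j₁ ≡ v) → Dec (j₂ ≡ v) → OrderedInputs z
    by-cases (yes j₁≡v) _ = record
      { p = j₁ ; q = j₂ ; p→z = arc₁ ; q→z = arc₂ ; p≢q = distinct
      ; q≢v = λ j₂≡v → distinct (trans j₁≡v (sym j₂≡v)) ; p≤q = λ j₁≢v → contradiction j₁≡v j₁≢v }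
    by-cases (no _) (yes j₂≡v) = record
      { p = j₂ ; q = j₁ ; p→z = arc₂ ; q→z = arc₁ ; p≢q = λ e → distinct (sym e)
      ; q≢v = λ j₁≡v → distinct (trans j₁≡v (sym j₂≡v)) ; p≤q = λ j₂≢v → contradiction j₂≡v j₂≢v }
    by-cases (no j₁≢v) (no j₂≢v) with rank j₁ ≤? rank j₂
    ... | yes j₁≤j₂ = record
      { p = j₁ ; q = j₂ ; p→z = arc₁ ; q→z = arc₂ ; p≢q = distinct ; q≢v = j₂≢v ; p≤q = λ _ → j₁≤j₂ }
    ... | no  j₁≰j₂ = record
      { p = j₂ ; q = j₁ ; p→z = arc₂ ; q→z = arc₁ ; p≢q = λ e → distinct (sym e)
      ; q≢v = j₁≢v ; p≤q = λ _ → <⇒≤ (≰⇒> j₁≰j₂) }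

  mixer : MixSite → Mixer G v
  mixer site = record
    { z = z ; p = p ; q = q ; p→z = p→z ; q→z = q→z
    ; InA = InA ; InS = InS ; A? = A? ; S? = S?
    ; v∉A = λ (t , e) → avoids-vertex path avoids t e
    ; A-closed = A-closed
    ; v-inputs = last-input path forced
    ; S-closed = S-closed
    ; p-flips = p-flips
    ; q≢v = q≢v
    ; q∉A = λ (t , e) → input∉avoiding path avoids q→z q≢v t e
    ; q∉S = λ { (_ , inj₁ q<q) → <-irrefl refl q<q ; (_ , inj₂ q≡p) → p≢q (sym q≡p) }
    }
    where
    open MixSite site
    open OrderedInputs (order inputs)

    InA InS : Fin (suc m) → Set
    InA u = ∃ λ t → vertex path (inject₁ t) ≡ u
    InS u = u ≢ v × (rank u < rank q ⊎ u ≡ p)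

    A? : Decidable InA
    A? u = any? λ t → vertex path (inject₁ t) ≟ u

    S? : Decidable InS
    S? u = ¬? (u ≟ v) ×-dec (rank u <? rank q ⊎-dec u ≟ p)

    A-closed : ∀ {u j s} → InA u → u ≢ z → G j u s ≡ true → InA j
    A-closed (zero    , refl) z≢z _ = contradiction refl z≢z
    A-closed (suc t , refl) _   a = inject₁ t , sym (proj₁ (forced (inject₁ t) a))

    S-closed : ∀ {u j s} → InS u → G j u s ≡ true → j ≢ v → InS j
    S-closed (u≢v , below) a j≢v = j≢v , inj₁ (<-≤-trans (rank-arc a j≢v u≢v) (rank≤q u≢v below))
      where
      rank≤q : ∀ {u} → u ≢ v → rank u < rank q ⊎ u ≡ p → rank u ≤ rank q
      rank≤q _   (inj₁ u<q)  = <⇒≤ u<q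
      rank≤q p≢v (inj₂ refl) = p≤q p≢v

    p-flips : p ≡ v ⊎ InS p
    p-flips with p ≟ v
    ... | yes p≡v = inj₁ p≡v
    ... | no  p≢v = inj₂ (p≢v , inj₂ refl)

subset-≤1-unique : ∀ {n} {S : Subset n} → ∣ S ∣ ≤ 1 → ∀ {x y} → x ∈ₛ S → y ∈ₛ S → x ≡ y
subset-≤1-unique {S = S} ∣S∣≤1 {x} {y} x∈S y∈S with x ≟ y
... | yes x≡y = x≡y
... | no  x≢y = contradiction (subst (_< ∣ S ∣) (∣⁅x⁆∣≡1 x) (p⊂q⇒∣p∣<∣q∣ ⁅x⁆⊂S)) (≤⇒≯ ∣S∣≤1)
  where
  ⁅x⁆⊆S : ⁅ x ⁆ ⊆ S
  ⁅x⁆⊆S u∈⁅x⁆ = subst (_∈ₛ S) (sym (x∈⁅y⁆⇒x≡y x u∈⁅x⁆)) x∈S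
  ⁅x⁆⊂S : ⁅ x ⁆ ⊂ S
  ⁅x⁆⊂S = ⁅x⁆⊆S , y , y∈S , x≢y⇒x∉⁅y⁆ (λ e → x≢y (sym e))

τ≤1⇒feedbackVertex : ∀ {m} {G : SignedDigraph (suc m)} → τ≤ G 1 → ∃ (MeetsEveryCycle G)
τ≤1⇒feedbackVertex (S , meets , ∣S∣≤1) with nonempty? S
... | yes (v , v∈S) = v , λ C → let (t , e) = meets C in t , subset-≤1-unique ∣S∣≤1 e v∈S
... | no  empty     = zero , λ C → contradiction (_ , proj₂ (meets C)) empty

sourceless-unique : ∀ {n} {G : SignedDigraph n} {c} → StronglyConnected G → ¬ HasInput G c → ∀ u → u ≡ c
sourceless-unique {G = G} {c} sc no-input u = reach-c (sc u c)
  where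
  reach-c : ∀ {u} → Reach G u c → u ≡ c
  reach-c here         = refl
  reach-c (step s _ a) = contradiction (_ , s , a) no-input

sourceless-synchronizes : ∀ {n} {G : SignedDigraph n} {c} → StronglyConnected G → ¬ HasInput G c →
                          SynchronizingWord G (c ∷ [])
sourceless-synchronizes {G = G} {c} sc no-input f (_ , andOr) x y k with sourceless-unique sc no-input k
... | refl = begin
  update f c x c  ≡⟨ update-self f c x ⟩
  f x c           ≡⟨ local (λ a → contradiction (_ , _ , a) no-input) ⟩
  f y c           ≡⟨ update-self f c y ⟨
  update f c y c  ∎
  where
  open ≡-Reasoning
  open AndOr G andOr

pad : ∀ {n} {G : SignedDigraph n} N (u : Fin n) → (Σ (List (Fin n)) λ w → length w ≤ N × SynchronizingWord G w) →
      Σ (List (Fin n)) λ w → length w ≡ N × SynchronizingWord G w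
pad N u (w , |w|≤N , sync) =
  replicate (N ∸ length w) u ++ w ,
  trans (length-++ (replicate (N ∸ length w) u))
        (trans (cong (_+ length w) (length-replicate (N ∸ length w))) (m∸n+n≡m |w|≤N)) ,
  λ f net → synchronizes-++ˡ f (replicate (N ∸ length w) u) (sync f net)

short-synchronizing-word : ∀ {m} (G : SignedDigraph (suc m)) →
  StronglyConnected G → NoPositiveCycle G → ¬ IsCycle G → τ≤ G 1 →
  Σ (List (Fin (suc m))) λ w → length w ≤ 3 * suc m ∸ 1 × SynchronizingWord G w
short-synchronizing-word {m} G sc no+ ¬cycle τ≤1 with τ≤1⇒feedbackVertex τ≤1 | all? (λ u → any? λ j → arc? G j u)
... | v , fvs | yes has-input = word , length-word , synchronizing
  where
  open Chain G v no+ fvs sc has-input using (mixer; mixSite)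
  open Synchronization G v no+ fvs sc has-input (mixer (mixSite ¬cycle))
... | _ | no some-sourceless =
  let (c , no-input) = ¬∀⟶∃¬ _ _ (λ u → any? λ j → arc? G j u) some-sourceless
  in  c ∷ [] , ≤-trans (s≤s z≤n) (m≤n+m _ m) , sourceless-synchronizes sc no-input

proposition5 : (n : ℕ) (G : SignedDigraph n) →
    StronglyConnected G → NoPositiveCycle G → ¬ IsCycle G → τ≤ G 1 →
    Σ (List (Fin n)) λ w → length w ≡ 3 * n ∸ 1 ×
      ((f : BN n) → AndOrNet G f → Synchronizes f w)
proposition5 zero    G _  _   _      _   = [] , refl , λ _ _ _ _ ()
proposition5 (suc m) G sc no+ ¬cycle τ≤1 = pad {G = G} (3 * suc m ∸ 1) zero (short-synchronizing-word G sc no+ ¬cycle τ≤1)
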